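{- Let $\Gamma$ be a typing environment and $\tau$ a type such that there is a $\lambda$-term $t$ with $\Gamma\vdash_{\mathcal S} t:\tau$. Then for every variable $x$ and every type $\sigma$ there is a $\lambda$-term $u$ with $\Gamma+x{:}[\sigma]\vdash_{\mathcal S} u:\tau$.
   Context: Types: $\sigma,\tau,\rho::=\alpha\mid A\to\tau$, $\alpha$ base types, multiset types $A=[\sigma_i]_{i\in I}$ finite possibly empty multisets of types ($[\,]$ the empty one). Environments $\Gamma$ map variables to multiset types, all but finitely many to $[\,]$; $(\Gamma+\Delta)(y)=\Gamma(y)\uplus\Delta(y)$; $\Gamma\setminus y$ sets $y$ to $[\,]$; $x{:}A$ maps $x$ to $A$, others to $[\,]$. System $\mathcal S$: (var) $x{:}[\rho]\vdash x:\rho$; ($\to$I) from $\Gamma\vdash t:\tau$ infer $\Gamma\setminus x\vdash\lambda x.t:\Gamma(x)\to\tau$; ($\to$E$_{\ne[]}$) from $\Gamma\vdash t:A\to\tau$, $\Delta\vdash u:A$, $A\ne[\,]$, infer $\Gamma+\Delta\vdash tu:\tau$; ($\to$E$_{[]}$) from $\Gamma\vdash t:[\,]\to\tau$ and $\Delta\vdash u:[\sigma]$ infer $\Gamma+\Delta\vdash tu:\tau$; (m) from $(\Delta_i\vdash t:\sigma_i)_{i\in I}$ ($I$ finite, possibly empty) infer $+_{i\in I}\Delta_i\vdash t:[\sigma_i]_{i\in I}$. -}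

module Defs where

open import Data.Nat using (ℕ; _≟_; _≤_)
open import Data.List using (List; []; _∷_; _++_)
open import Data.List.Relation.Binary.Permutation.Propositional using (_↭_)
open import Relation.Nullary using (yes; no; ¬_)
open import Data.Product using (∃)
open import Relation.Binary.PropositionalEquality using (_≡_)

Var : Set
Var = ℕ

data Term : Set where
  var : Var → Term
  lam : Var → Term → Term
  app : Term → Term → Term

-- Types σ,τ ::= α | A → τ ; multiset types A are finite lists read up to permutation.
data Ty : Set where
  base : ℕ → Ty
  _⇒_  : List Ty → Ty → Ty

MTy : Set
MTy = List Ty

_≈ₘ_ : MTy → MTy → Set
A ≈ₘ B = A ↭ B

Env : Set
Env = Var → MTy

FiniteEnv : Env → Set
FiniteEnv Γ = ∃ λ n → ∀ y → n ≤ y → Γ y ≡ []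

_≈ₑ_ : Env → Env → Set
Γ ≈ₑ Δ = ∀ y → Γ y ≈ₘ Δ y

∅ : Env
∅ _ = []

_+ₑ_ : Env → Env → Env
(Γ +ₑ Δ) y = Γ y ++ Δ y

_∖_ : Env → Var → Env
(Γ ∖ x) y with y ≟ x
... | yes _ = []
... | no  _ = Γ y

_∶_ : Var → MTy → Env
(x ∶ A) y with y ≟ x
... | yes _ = A
... | no  _ = []

-- System S.  Judgements are taken up to equality of environments
-- (pointwise multiset equality), as environments are multiset-valued.
mutual
  data _⊢_∶_ : Env → Term → Ty → Set where
    ax   : ∀ {Γ x ρ} → Γ ≈ₑ (x ∶ (ρ ∷ [])) → Γ ⊢ var x ∶ ρ
    abs  : ∀ {Γ Γ' x t τ A} → Γ ⊢ t ∶ τ → Γ' ≈ₑ (Γ ∖ x) → A ≈ₘ Γ x →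
           Γ' ⊢ lam x t ∶ (A ⇒ τ)
    appₙ : ∀ {Γ Δ Θ t u τ A} → Γ ⊢ t ∶ (A ⇒ τ) → Δ ⊢ u ∶ₘ A → ¬ (A ≡ []) →
           Θ ≈ₑ (Γ +ₑ Δ) → Θ ⊢ app t u ∶ τ
    app₀ : ∀ {Γ Δ Θ t u τ σ} → Γ ⊢ t ∶ ([] ⇒ τ) → Δ ⊢ u ∶ₘ (σ ∷ []) →
           Θ ≈ₑ (Γ +ₑ Δ) → Θ ⊢ app t u ∶ τ

  data _⊢_∶ₘ_ : Env → Term → MTy → Set where
    m[] : ∀ {Γ t} → Γ ≈ₑ ∅ → Γ ⊢ t ∶ₘ []
    m∷  : ∀ {Γ Δ Θ t σ A} → Γ ⊢ t ∶ σ → Δ ⊢ t ∶ₘ A → Θ ≈ₑ (Γ +ₑ Δ) →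
          Θ ⊢ t ∶ₘ (σ ∷ A)

module Submission where

-- Take u = (λz.t) x with z outside the support of Γ: the vacuous binder gives λz.t : [] → τ
-- under Γ, and rule (→E[]) still types the argument x, contributing exactly x : [σ].

open import Defs
open import Data.Product using (∃; _,_)
open import Data.List using ([]; _∷_)
open import Data.List.Properties using (++-identityʳ)
open import Data.List.Relation.Binary.Permutation.Propositional using (↭-refl; ↭-reflexive)
open import Data.Nat using (_≟_)
open import Data.Nat.Properties using (≤-refl)
open import Relation.Nullary using (yes; no)
open import Relation.Binary.PropositionalEquality using (_≡_; refl; sym)

≈ₑ-refl : ∀ {Γ} → Γ ≈ₑ Γ
≈ₑ-refl _ = ↭-refl

FiniteEnv⇒fresh : ∀ {Γ} → FiniteEnv Γ → ∃ λ z → Γ z ≡ []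
FiniteEnv⇒fresh (n , fin) = n , fin n ≤-refl

∖-fresh : ∀ Γ z → Γ z ≡ [] → Γ ≈ₑ (Γ ∖ z)
∖-fresh Γ z Γz≡[] y with y ≟ z
... | yes refl = ↭-reflexive Γz≡[]
... | no  _    = ↭-refl

+ₑ-∅-identityʳ : ∀ Γ → Γ ≈ₑ (Γ +ₑ ∅)
+ₑ-∅-identityʳ Γ y = ↭-reflexive (sym (++-identityʳ (Γ y)))

var-∶ₘ-singleton : ∀ x σ → (x ∶ (σ ∷ [])) ⊢ var x ∶ₘ (σ ∷ [])
var-∶ₘ-singleton x σ = m∷ (ax ≈ₑ-refl) (m[] ≈ₑ-refl) (+ₑ-∅-identityʳ (x ∶ (σ ∷ [])))

lam-vacuous : ∀ {Γ t τ} z → Γ z ≡ [] → Γ ⊢ t ∶ τ → Γ ⊢ lam z t ∶ ([] ⇒ τ)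
lam-vacuous {Γ} z Γz≡[] ⊢t = abs ⊢t (∖-fresh Γ z Γz≡[]) (↭-reflexive (sym Γz≡[]))

app-lam-vacuous : ∀ {Γ Δ t u τ σ} z → Γ z ≡ [] → Γ ⊢ t ∶ τ → Δ ⊢ u ∶ₘ (σ ∷ []) →
                  (Γ +ₑ Δ) ⊢ app (lam z t) u ∶ τ
app-lam-vacuous z Γz≡[] ⊢t ⊢u = app₀ (lam-vacuous z Γz≡[] ⊢t) ⊢u ≈ₑ-refl

lemma4p6 : (Γ : Env) → FiniteEnv Γ → (τ : Ty) →
    ∃ (λ t → Γ ⊢ t ∶ τ) →
    (x : Var) (σ : Ty) →
    ∃ (λ u → (Γ +ₑ (x ∶ (σ ∷ []))) ⊢ u ∶ τ)
lemma4p6 Γ finΓ τ (t , ⊢t) x σ with FiniteEnv⇒fresh finΓ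
... | z , Γz≡[] = app (lam z t) (var x) , app-lam-vacuous z Γz≡[] ⊢t (var-∶ₘ-singleton x σ)
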